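{- Let $G$ be a graph with $n$ vertices. If $G$ is the join of two graphs $G_1$ and $G_2$, then $\chi_h(G)=n$. If $G$ is a quasi-spider $(R,C,S)$ with $k=\max\{|C|,|S|\}$, then $\chi_h(G)=|R|+k+1$ if $G$ is thin, and $\chi_h(G)=n$ otherwise.
   Context: The join $G_1\vee G_2$ is the disjoint union of $G_1,G_2$ plus all edges between them. A spider is a graph whose vertex set has a partition $(R,C,S)$ with $C=\{c_1,\dots,c_k\}$ a clique and $S=\{s_1,\dots,s_k\}$ a stable set, $k\ge 2$, such that either $s_i$ is adjacent to $c_j$ iff $i=j$ (thin) or $s_i$ is adjacent to $c_j$ iff $i\ne j$ (thick), and every vertex of $R$ is adjacent to every vertex of $C$ and to no vertex of $S$. A quasi-spider is obtained from a spider $(R,C,S)$ by replacing at most one vertex of $C\cup S$ by a $K_2$ or a $\overline{K_2}$ (the two new vertices having the same neighbours outside them as the replaced vertex), the new vertices belonging to the part of the replaced vertex; it is thin/thick according to the original spider. A $P_4$ is an induced path on four vertices. A coloring is a partition of the vertex set into color classes; proper if classes are stable; acyclic if proper and every cycle gets at least three colors; star if acyclic and every $P_4$ gets at least three colors; nonrepetitive if star and no path $v_1\cdots v_{2p}$ ($p\ge1$) has $v_i,v_{i+p}$ of the same color for all $i\le p$; harmonious if nonrepetitive and between any two distinct color classes there is at most one edge. $\chi_h(G)$ is the minimum number of colors of a harmonious coloring. -}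

module Defs where

open import Data.Nat using (ℕ; zero; suc; _+_; _<_; _≤_; _⊔_)
open import Data.Fin using (Fin; zero; suc; inject₁; fromℕ; _↑ˡ_; _↑ʳ_; _≟_)
open import Data.Bool using (Bool; true; false; not; if_then_else_)
open import Data.Sum using (_⊎_; inj₁; inj₂)
open import Data.Product using (Σ; _×_; _,_; ∃-syntax)
open import Data.Maybe using (Maybe; just; nothing)
open import Data.Empty using (⊥)
open import Data.Unit using (⊤)
open import Relation.Nullary using (¬_)
open import Relation.Nullary.Decidable using (⌊_⌋)
open import Relation.Binary.PropositionalEquality using (_≡_; _≢_)
open import Function.Definitions using (Injective)

record Graph (n : ℕ) : Set where
  field
    adj    : Fin n → Fin n → Bool
    sym    : ∀ u v → adj u v ≡ adj v u
    irrefl : ∀ u → adj u u ≡ false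

Adj : ∀ {n} → Graph n → Fin n → Fin n → Set
Adj G u v = Graph.adj G u v ≡ true

record _≅_ {n : ℕ} (G : Graph n) {X : Set} (adjX : X → X → Bool) : Set where
  field
    to       : Fin n → X
    from     : X → Fin n
    from∘to  : ∀ u → from (to u) ≡ u
    to∘from  : ∀ x → to (from x) ≡ x
    adj-pres : ∀ u v → Graph.adj G u v ≡ adjX (to u) (to v)

joinAdj : ∀ {n₁ n₂} → Graph n₁ → Graph n₂ → (Fin n₁ ⊎ Fin n₂) → (Fin n₁ ⊎ Fin n₂) → Bool
joinAdj G₁ G₂ (inj₁ u) (inj₁ v) = Graph.adj G₁ u v
joinAdj G₁ G₂ (inj₂ u) (inj₂ v) = Graph.adj G₂ u v
joinAdj G₁ G₂ (inj₁ u) (inj₂ v) = true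
joinAdj G₁ G₂ (inj₂ u) (inj₁ v) = true

-- Spiders and quasi-spiders
-- Base vertex type: R = Fin r, C = Fin k (c_i), S = Fin k (s_i)

SpBase : ℕ → ℕ → Set
SpBase r k = Fin r ⊎ (Fin k ⊎ Fin k)

pattern Rv i = inj₁ i
pattern Cv i = inj₂ (inj₁ i)
pattern Sv i = inj₂ (inj₂ i)

-- adjacency between c_i and s_j : thin (true) iff i = j, thick (false) iff i ≠ j
legAdj : ∀ {k} → Bool → Fin k → Fin k → Bool
legAdj true  i j = ⌊ i ≟ j ⌋
legAdj false i j = not ⌊ i ≟ j ⌋

spAdj : ∀ {r k} → Bool → (Fin r → Fin r → Bool) → SpBase r k → SpBase r k → Bool
spAdj th adjR (Rv i) (Rv j) = adjR i j
spAdj th adjR (Rv i) (Cv j) = true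
spAdj th adjR (Rv i) (Sv j) = false
spAdj th adjR (Cv i) (Rv j) = true
spAdj th adjR (Sv i) (Rv j) = false
spAdj th adjR (Cv i) (Cv j) = not ⌊ i ≟ j ⌋
spAdj th adjR (Sv i) (Sv j) = false
spAdj th adjR (Cv i) (Sv j) = legAdj th i j
spAdj th adjR (Sv i) (Cv j) = legAdj th j i

-- Optional replacement: nothing = plain spider;
-- just (b , t) = vertex t ∈ C ∪ S replaced by two vertices (t and a twin),
-- adjacent to each other iff b (b = true : K₂, b = false : co-K₂)
TwinSpec : ℕ → Set
TwinSpec k = Maybe (Bool × (Fin k ⊎ Fin k))

Twin : ∀ {k} → TwinSpec k → Set
Twin nothing  = ⊥
Twin (just _) = ⊤

QSV : (r k : ℕ) → TwinSpec k → Set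
QSV r k tw = SpBase r k ⊎ Twin tw

isOrig : ∀ {r k} → (Fin k ⊎ Fin k) → SpBase r k → Bool
isOrig (inj₁ t) (Cv i) = ⌊ t ≟ i ⌋
isOrig (inj₂ t) (Sv i) = ⌊ t ≟ i ⌋
isOrig _ _ = false

twinAdj : ∀ {r k} → Bool → (Fin r → Fin r → Bool) → Bool → (Fin k ⊎ Fin k) → SpBase r k → Bool
twinAdj th adjR b t x = if isOrig t x then b else spAdj th adjR x (inj₂ t)

qsAdj : (th : Bool) (r k : ℕ) → (Fin r → Fin r → Bool) → (tw : TwinSpec k) → QSV r k tw → QSV r k tw → Bool
qsAdj th r k adjR tw (inj₁ x) (inj₁ y) = spAdj th adjR x y
qsAdj th r k adjR (just (b , t)) (inj₁ x) (inj₂ _) = twinAdj th adjR b t x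
qsAdj th r k adjR (just (b , t)) (inj₂ _) (inj₁ x) = twinAdj th adjR b t x
qsAdj th r k adjR (just (b , t)) (inj₂ _) (inj₂ _) = false

sizeC : ∀ {k} → TwinSpec k → ℕ
sizeC {k} (just (_ , inj₁ _)) = suc k
sizeC {k} _ = k

sizeS : ∀ {k} → TwinSpec k → ℕ
sizeS {k} (just (_ , inj₂ _)) = suc k
sizeS {k} _ = k

IsQuasiSpider : ∀ {n} → Graph n → (th : Bool) (r k : ℕ) → (Fin r → Fin r → Bool) → TwinSpec k → Set
IsQuasiSpider G th r k adjR tw = (2 ≤ k) × (G ≅ qsAdj th r k adjR tw)

IsThinQuasiSpider : ∀ {n} → Graph n → Set
IsThinQuasiSpider G = ∃[ r ] ∃[ k ] Σ (Fin r → Fin r → Bool) λ adjR → Σ (TwinSpec k) λ tw →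
  IsQuasiSpider G true r k adjR tw

module _ {n : ℕ} (G : Graph n) {m : ℕ} (c : Fin n → Fin m) where

  IsPath : ∀ {k} → (Fin (suc k) → Fin n) → Set
  IsPath {k} v = Injective _≡_ _≡_ v × (∀ (i : Fin k) → Adj G (v (inject₁ i)) (v (suc i)))

  IsCycle : ∀ {k} → (Fin (suc (suc (suc k))) → Fin n) → Set
  IsCycle {k} v = IsPath v × Adj G (v (fromℕ (suc (suc k)))) (v zero)

  IsP4 : (Fin 4 → Fin n) → Set
  IsP4 v = IsPath v × ¬ Adj G (v (# 0)) (v (# 2)) × ¬ Adj G (v (# 1)) (v (# 3))
                    × ¬ Adj G (v (# 0)) (v (# 3))
    where
    open import Data.Fin using (#_)

  AtLeast3Colors : ∀ {k} → (Fin k → Fin n) → Set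
  AtLeast3Colors {k} v = ∃[ i ] ∃[ j ] ∃[ l ]
    (c (v i) ≢ c (v j) × c (v i) ≢ c (v l) × c (v j) ≢ c (v l))

  Proper : Set
  Proper = ∀ u v → Adj G u v → c u ≢ c v

  Acyclic : Set
  Acyclic = Proper × (∀ k (v : Fin (suc (suc (suc k))) → Fin n) → IsCycle v → AtLeast3Colors v)

  Star : Set
  Star = Acyclic × (∀ (v : Fin 4 → Fin n) → IsP4 v → AtLeast3Colors v)

  Nonrepetitive : Set
  Nonrepetitive = Star × (∀ q (v : Fin (suc q + suc q) → Fin n) → IsPath v →
    ¬ (∀ (i : Fin (suc q)) → c (v (i ↑ˡ suc q)) ≡ c (v (suc q ↑ʳ i))))

  Harmonious : Set
  Harmonious = Nonrepetitive × (∀ u v x y → Adj G u v → Adj G x y → c u ≢ c v →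
    c u ≡ c x → c v ≡ c y → (u ≡ x × v ≡ y))

HasHarmonious : ∀ {n} → Graph n → ℕ → Set
HasHarmonious {n} G m = Σ (Fin n → Fin m) (Harmonious G)

ChiH≡ : ∀ {n} → Graph n → ℕ → Set
ChiH≡ G m = HasHarmonious G m × (∀ m′ → m′ < m → ¬ HasHarmonious G m′)

-- If every colour class carries at most one edge to every other class, then two
-- vertices at distance at most two must get different colours: an edge, or a common
-- neighbour w, would put two edges between the classes of w and of the pair.  So a set
-- of pairwise close vertices bounds χ_h from below, and a colouring that is proper and
-- edge-injective is automatically harmonious (a repetition v₀…v_{2p} would give the two
-- edges v₀v₁ and v_p v_{p+1} between the same two classes).
-- Joins and thick quasi-spiders with k ≥ 3 have diameter two, so χ_h = n; a thick
-- quasi-spider with k = 2 is also a thin one (exchange s₁ and s₂).  A thin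
-- quasi-spider is coloured by giving all original vertices of S one colour and every
-- other vertex its own: no two S-vertices have a common neighbour.  The lower bound
-- comes from R ∪ C ∪ {twin} ∪ {one s_z}, which has diameter two.

module Submission where

open import Defs
open import Data.Nat using (ℕ; zero; suc; _+_; _⊔_; _≤_; s≤s; z≤n)
open import Data.Nat.Properties using (<⇒≱; +-comm; +-identityʳ; ⊔-idem; n≤1+n; m≤n⇒m⊔n≡n; m≥n⇒m⊔n≡m)
open import Data.Fin using (Fin; zero; suc; inject₁; opposite; _↑ˡ_; _↑ʳ_; _≟_)
open import Data.Fin.Properties using (0≢1+n; injective⇒≤; +↔⊎; opposite-involutive)
open import Data.Bool using (Bool; true; false; not; if_then_else_)
open import Data.Bool.Properties using (T-≡)
open import Data.Sum using (_⊎_; inj₁; inj₂)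
open import Data.Sum.Properties using (≡-dec)
open import Data.Sum.Function.Propositional using (_⊎-↔_)
open import Data.Product as Product using (_×_; _,_; ∃-syntax; proj₁; proj₂; map₂)
open import Data.Maybe as Maybe using (just; nothing)
open import Data.Unit using (⊤; tt)
open import Data.Empty using (⊥-elim)
open import Function using (_∘_; _↔_; Inverse; Injection; Equivalence; mk↔ₛ′)
open import Function.Definitions using (Injective)
open import Function.Properties.Inverse using (↔-refl; ↔-trans; ↔-sym; ↔⇒↣)
open import Relation.Nullary using (¬_; yes; no)
open import Relation.Nullary.Decidable using (⌊_⌋; isYes≗does; dec-true; dec-false; toWitness)
open import Relation.Binary.PropositionalEquality using (_≡_; _≢_; refl; sym; trans; cong; cong₂; subst; module ≡-Reasoning)

true≢false : true ≢ false
true≢false ()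

≟-refl : ∀ {k} (i : Fin k) → ⌊ i ≟ i ⌋ ≡ true
≟-refl i = trans (isYes≗does (i ≟ i)) (dec-true (i ≟ i) refl)

≟-≢ : ∀ {k} {i j : Fin k} → i ≢ j → ⌊ i ≟ j ⌋ ≡ false
≟-≢ {i = i} {j} i≢j = trans (isYes≗does (i ≟ j)) (dec-false (i ≟ j) i≢j)

≟-sound : ∀ {k} {i j : Fin k} → ⌊ i ≟ j ⌋ ≡ true → i ≡ j
≟-sound p = toWitness (Equivalence.from T-≡ p)

≟-sym : ∀ {k} (i j : Fin k) → ⌊ i ≟ j ⌋ ≡ ⌊ j ≟ i ⌋
≟-sym i j with i ≟ j
... | yes refl = sym (≟-refl i)
... | no i≢j = sym (≟-≢ (i≢j ∘ sym))

not-≟-≢ : ∀ {k} {i j : Fin k} → i ≢ j → not ⌊ i ≟ j ⌋ ≡ true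
not-≟-≢ i≢j = cong not (≟-≢ i≢j)

if-else-false : ∀ c {b} → (if c then b else false) ≡ true → c ≡ true
if-else-false true _ = refl

inject₁-↑ʳ-suc : ∀ q {p} (i : Fin p) → inject₁ (q ↑ʳ suc i) ≡ suc (q ↑ʳ inject₁ i)
inject₁-↑ʳ-suc zero i = refl
inject₁-↑ʳ-suc (suc q) i = cong suc (inject₁-↑ʳ-suc q i)

↔-from-injective : ∀ {A B : Set} (e : A ↔ B) → Injective _≡_ _≡_ (Inverse.from e)
↔-from-injective e = Injection.injective (↔⇒↣ (↔-sym e))

↔-to-injective : ∀ {A B : Set} (e : A ↔ B) → Injective _≡_ _≡_ (Inverse.to e)
↔-to-injective e = Injection.injective (↔⇒↣ e)

module _ {X C : Set} (A : X → X → Bool) (κ : X → C) where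

  ProperOn : Set
  ProperOn = ∀ x y → A x y ≡ true → κ x ≢ κ y

  EdgeInjectiveOn : Set
  EdgeInjectiveOn = ∀ x y x′ y′ → A x y ≡ true → A x′ y′ ≡ true →
    κ x ≡ κ x′ → κ y ≡ κ y′ → x ≡ x′ × y ≡ y′

Separated : {X : Set} → (X → X → Bool) → X → X → Set
Separated A x y = A x y ≡ true ⊎ ∃[ w ] (A x w ≡ true × A y w ≡ true)

module _ {n : ℕ} (G : Graph n) where

  adj-sym : ∀ {u v} → Adj G u v → Adj G v u
  adj-sym {u} {v} = trans (Graph.sym G v u)

  adj-irrefl : ∀ {u} → ¬ Adj G u u
  adj-irrefl {u} p = true≢false (trans (sym p) (Graph.irrefl G u))

  module _ {m : ℕ} {c : Fin n → Fin m} (proper : Proper G c)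
           (edge-inj : EdgeInjectiveOn (Graph.adj G) c) where

    path-atLeast3Colors : ∀ {k} (v : Fin (suc (suc (suc k))) → Fin n) → IsPath G c v → AtLeast3Colors G c v
    path-atLeast3Colors v (v-inj , e) =
      zero , suc zero , suc (suc zero) , proper _ _ (e zero) , ends , proper _ _ (e (suc zero))
      where
      ends : c (v zero) ≢ c (v (suc (suc zero)))
      ends eq = 0≢1+n (v-inj (proj₂ (edge-inj _ _ _ _ (adj-sym (e zero)) (e (suc zero)) refl eq)))

    path-nonrepetitive : ∀ q (v : Fin (suc q + suc q) → Fin n) → IsPath G c v →
      ¬ (∀ (i : Fin (suc q)) → c (v (i ↑ˡ suc q)) ≡ c (v (suc q ↑ʳ i)))
    path-nonrepetitive zero v (_ , e) rep = proper _ _ (e zero) (rep zero)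
    path-nonrepetitive (suc q) v (v-inj , e) rep =
      0≢1+n (v-inj (proj₁ (edge-inj _ _ _ _ (e zero) second-edge (rep zero) (rep (suc zero)))))
      where
      second-edge : Adj G (v (suc (suc q) ↑ʳ zero)) (v (suc (suc q) ↑ʳ suc zero))
      second-edge = subst (λ i → Adj G (v i) (v (suc (suc q) ↑ʳ suc zero)))
                          (inject₁-↑ʳ-suc (suc q) zero) (e (suc q ↑ʳ suc zero))

    proper∧edgeInjective⇒harmonious : Harmonious G c
    proper∧edgeInjective⇒harmonious =
      (((proper , λ _ v cycle → path-atLeast3Colors v (proj₁ cycle)) ,
        λ v p4 → path-atLeast3Colors v (proj₁ p4)) , path-nonrepetitive) ,
      λ u v x y a b _ eq eq′ → edge-inj u v x y a b eq eq′

  id-harmonious : HasHarmonious G n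
  id-harmonious = (λ u → u) , proper∧edgeInjective⇒harmonious
    (λ u v a u≡v → adj-irrefl (subst (Adj G u) (sym u≡v) a))
    (λ _ _ _ _ _ _ u≡x v≡y → u≡x , v≡y)

  separated⇒colour≢ : ∀ {m} {c : Fin n → Fin m} → Harmonious G c →
    ∀ {u x} → u ≢ x → Separated (Graph.adj G) u x → c u ≢ c x
  separated⇒colour≢ ((((proper , _) , _) , _) , _) _ (inj₁ a) = proper _ _ a
  separated⇒colour≢ ((((proper , _) , _) , _) , edge-inj) u≢x (inj₂ (w , a , b)) eq =
    u≢x (proj₁ (edge-inj _ w _ w a b (proper _ _ a) eq refl))

  ChiH≡-intro : ∀ {N} → HasHarmonious G N → (∀ m → HasHarmonious G m → N ≤ m) → ChiH≡ G N
  ChiH≡-intro colouring minimal = colouring , λ m m<N h → <⇒≱ m<N (minimal m h)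

module _ {n : ℕ} {G : Graph n} {X : Set} {A : X → X → Bool} (iso : G ≅ A) where
  open _≅_ iso

  to-injective : Injective _≡_ _≡_ to
  to-injective {u} {v} eq = trans (sym (from∘to u)) (trans (cong from eq) (from∘to v))

  from-injective : Injective _≡_ _≡_ from
  from-injective {x} {y} eq = trans (sym (to∘from x)) (trans (cong to eq) (to∘from y))

  ≅-adj-from : ∀ x y → Graph.adj G (from x) (from y) ≡ A x y
  ≅-adj-from x y = trans (adj-pres (from x) (from y)) (cong₂ A (to∘from x) (to∘from y))

  ≅-sym : ∀ x y → A x y ≡ A y x
  ≅-sym x y = trans (sym (≅-adj-from x y)) (trans (Graph.sym G _ _) (≅-adj-from y x))

  ≅-irrefl : ∀ x → A x x ≡ false
  ≅-irrefl x = trans (sym (≅-adj-from x x)) (Graph.irrefl G (from x))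

  ≅-separated : ∀ {x y} → Separated A x y → Separated (Graph.adj G) (from x) (from y)
  ≅-separated (inj₁ a) = inj₁ (trans (≅-adj-from _ _) a)
  ≅-separated (inj₂ (w , a , b)) = inj₂ (from w , trans (≅-adj-from _ _) a , trans (≅-adj-from _ _) b)

  ≅-harmonious : ∀ {m} (κ : X → Fin m) → ProperOn A κ → EdgeInjectiveOn A κ → Harmonious G (κ ∘ to)
  ≅-harmonious κ proper edge-inj = proper∧edgeInjective⇒harmonious G
    (λ u v a → proper (to u) (to v) (to-adj a))
    (λ u v x y a b eq eq′ → Product.map to-injective to-injective (edge-inj _ _ _ _ (to-adj a) (to-adj b) eq eq′))
    where
    to-adj : ∀ {u v} → Adj G u v → A (to u) (to v) ≡ true
    to-adj {u} {v} = trans (sym (adj-pres u v))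

  separatedFamily⇒≤ : ∀ {N m} (g : Fin N → X) → Injective _≡_ _≡_ g →
    (∀ i j → g i ≢ g j → Separated A (g i) (g j)) → HasHarmonious G m → N ≤ m
  separatedFamily⇒≤ g g-inj sep (c , harmonious) = injective⇒≤ colours-injective
    where
    colours-injective : Injective _≡_ _≡_ (c ∘ from ∘ g)
    colours-injective {i} {j} eq with i ≟ j
    ... | yes i≡j = i≡j
    ... | no i≢j = ⊥-elim (separated⇒colour≢ G harmonious (gi≢gj ∘ from-injective) (≅-separated (sep i j gi≢gj)) eq)
      where
      gi≢gj : g i ≢ g j
      gi≢gj = i≢j ∘ g-inj

  diameter≤2⇒χh≡n : (∀ x y → x ≢ y → Separated A x y) → ChiH≡ G n
  diameter≤2⇒χh≡n sep =
    ChiH≡-intro G (id-harmonious G) (λ _ → separatedFamily⇒≤ to to-injective (λ i j → sep (to i) (to j)))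

≅-transport : ∀ {n} {G : Graph n} {X Y : Set} {A : X → X → Bool} {B : Y → Y → Bool} (e : X ↔ Y) →
  (∀ x x′ → A x x′ ≡ B (Inverse.to e x) (Inverse.to e x′)) → G ≅ A → G ≅ B
≅-transport e A≡B iso = record
  { to       = Inverse.to e ∘ to
  ; from     = from ∘ Inverse.from e
  ; from∘to  = λ u → trans (cong from (Inverse.strictlyInverseʳ e (to u))) (from∘to u)
  ; to∘from  = λ y → trans (cong (Inverse.to e) (to∘from _)) (Inverse.strictlyInverseˡ e y)
  ; adj-pres = λ u v → trans (adj-pres u v) (A≡B (to u) (to v))
  }
  where open _≅_ iso

module _ {X C : Set} {A : X → X → Bool} (A-sym : ∀ x y → A x y ≡ A y x) (A-irrefl : ∀ x → A x x ≡ false)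
         {S : X → Set} {κ : X → C}
         (κ-fibres : ∀ x y → κ x ≡ κ y → x ≡ y ⊎ (S x × S y))
         (S-independent : ∀ x y → S x → S y → A x y ≡ false)
         (S-privateNeighbours : ∀ v x y → A v x ≡ true → A v y ≡ true → S x → S y → x ≡ y) where

  collapse-proper : ProperOn A κ
  collapse-proper x y a eq with κ-fibres x y eq
  ... | inj₁ refl = true≢false (trans (sym a) (A-irrefl x))
  ... | inj₂ (Sx , Sy) = true≢false (trans (sym a) (S-independent x y Sx Sy))

  collapse-edgeInjective : EdgeInjectiveOn A κ
  collapse-edgeInjective x y x′ y′ a a′ eq eq′ with κ-fibres x x′ eq | κ-fibres y y′ eq′
  ... | inj₁ refl       | inj₁ refl       = refl , refl
  ... | inj₁ refl       | inj₂ (Sy , Sy′) = refl , S-privateNeighbours x y y′ a a′ Sy Sy′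
  ... | inj₂ (Sx , Sx′) | inj₁ refl       =
    S-privateNeighbours y x x′ (trans (A-sym y x) a) (trans (A-sym y x′) a′) Sx Sx′ , refl
  ... | inj₂ (Sx , _)   | inj₂ (Sy , _)   = ⊥-elim (true≢false (trans (sym a) (S-independent x y Sx Sy)))

join-separated : ∀ {n₁ n₂} (G₁ : Graph (suc n₁)) (G₂ : Graph (suc n₂)) x y → Separated (joinAdj G₁ G₂) x y
join-separated G₁ G₂ (inj₁ _) (inj₁ _) = inj₂ (inj₂ zero , refl , refl)
join-separated G₁ G₂ (inj₁ _) (inj₂ _) = inj₁ refl
join-separated G₁ G₂ (inj₂ _) (inj₁ _) = inj₁ refl
join-separated G₁ G₂ (inj₂ _) (inj₂ _) = inj₂ (inj₁ zero , refl , refl)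

base : ∀ {r k} {tw : TwinSpec k} → QSV r k tw → SpBase r k
base (inj₁ x) = x
base {tw = just (_ , t)} (inj₂ _) = inj₂ t

module _ (th : Bool) {r k : ℕ} (adjR : Fin r → Fin r → Bool) where

  spAdj-leg-irrefl : ∀ t → spAdj {r} {k} th adjR (inj₂ t) (inj₂ t) ≡ false
  spAdj-leg-irrefl (inj₁ i) = cong not (≟-refl i)
  spAdj-leg-irrefl (inj₂ i) = refl

  spAdj-leg-≢ : ∀ t {w} → spAdj {r} {k} th adjR (inj₂ t) w ≡ true → w ≢ inj₂ t
  spAdj-leg-≢ t p refl = true≢false (trans (sym p) (spAdj-leg-irrefl t))

  spAdj-leg-sym : ∀ x t → spAdj {r} {k} th adjR x (inj₂ t) ≡ spAdj th adjR (inj₂ t) x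
  spAdj-leg-sym (Rv i) (inj₁ j) = refl
  spAdj-leg-sym (Rv i) (inj₂ j) = refl
  spAdj-leg-sym (Cv i) (inj₁ j) = cong not (≟-sym i j)
  spAdj-leg-sym (Cv i) (inj₂ j) = refl
  spAdj-leg-sym (Sv i) (inj₁ j) = refl
  spAdj-leg-sym (Sv i) (inj₂ j) = refl

  isOrig-sound : ∀ t (x : SpBase r k) → isOrig t x ≡ true → x ≡ inj₂ t
  isOrig-sound (inj₁ t) (Cv i) p = cong Cv (sym (≟-sound p))
  isOrig-sound (inj₂ t) (Sv i) p = cong Sv (sym (≟-sound p))

  twinAdj-other : ∀ b t (x : SpBase r k) → x ≢ inj₂ t → twinAdj th adjR b t x ≡ spAdj th adjR x (inj₂ t)
  twinAdj-other b t x x≢t with isOrig t x in eq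
  ... | true = ⊥-elim (x≢t (isOrig-sound t x eq))
  ... | false = refl

  qsAdj-spider : ∀ {tw} (x : QSV r k tw) w → spAdj th adjR (base x) w ≡ true → qsAdj th r k adjR tw x (inj₁ w) ≡ true
  qsAdj-spider (inj₁ x) w p = p
  qsAdj-spider {just (b , t)} (inj₂ _) w p =
    trans (twinAdj-other b t w (spAdj-leg-≢ t p)) (trans (spAdj-leg-sym w t) p)

  qsAdj-lift : ∀ {tw} (x y : QSV r k tw) → base x ≢ base y →
    spAdj th adjR (base x) (base y) ≡ true → qsAdj th r k adjR tw x y ≡ true
  qsAdj-lift x (inj₁ y) _ p = qsAdj-spider x y p
  qsAdj-lift {just (b , t)} (inj₁ x) (inj₂ _) x≢t p = trans (twinAdj-other b t x x≢t) p
  qsAdj-lift {just _} (inj₂ _) (inj₂ _) t≢t _ = ⊥-elim (t≢t refl)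

  -- A vertex and its twin share the spider-neighbours of the replaced vertex.
  qs-separated : ∀ {tw} → (∀ a → ∃[ w ] spAdj th adjR a w ≡ true) → (x y : QSV r k tw) → x ≢ y →
    (base x ≢ base y → Separated (spAdj th adjR) (base x) (base y)) → Separated (qsAdj th r k adjR tw) x y
  qs-separated noIsolated x y x≢y sep with ≡-dec _≟_ (≡-dec _≟_ _≟_) (base x) (base y)
  ... | no bx≢by with sep bx≢by
  ...   | inj₁ a = inj₁ (qsAdj-lift x y bx≢by a)
  ...   | inj₂ (w , a , b) = inj₂ (inj₁ w , qsAdj-spider x w a , qsAdj-spider y w b)
  qs-separated noIsolated x y x≢y sep | yes bx≡by with noIsolated (base x)
  ... | w , a = inj₂ (inj₁ w , qsAdj-spider x w a , qsAdj-spider y w (subst (λ z → spAdj th adjR z w ≡ true) bx≡by a))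

-- Thick quasi-spiders

avoid : ∀ {k} (i j : Fin (suc (suc (suc k)))) → ∃[ l ] (l ≢ i × l ≢ j)
avoid zero zero = suc zero , (λ ()) , (λ ())
avoid zero (suc zero) = suc (suc zero) , (λ ()) , (λ ())
avoid zero (suc (suc _)) = suc zero , (λ ()) , (λ ())
avoid (suc zero) zero = suc (suc zero) , (λ ()) , (λ ())
avoid (suc (suc _)) zero = suc zero , (λ ()) , (λ ())
avoid (suc _) (suc _) = zero , (λ ()) , (λ ())

module _ {r k : ℕ} (adjR : Fin r → Fin r → Bool) where

  thick-separated : ∀ (a b : SpBase r (suc (suc (suc k)))) → a ≢ b → Separated (spAdj false adjR) a b
  thick-separated (Rv _) (Rv _) _ = inj₂ (Cv zero , refl , refl)
  thick-separated (Rv _) (Cv _) _ = inj₁ refl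
  thick-separated (Cv _) (Rv _) _ = inj₁ refl
  thick-separated (Rv _) (Sv j) _ = let (l , l≢j , _) = avoid j j in inj₂ (Cv l , refl , not-≟-≢ l≢j)
  thick-separated (Sv j) (Rv _) _ = let (l , l≢j , _) = avoid j j in inj₂ (Cv l , not-≟-≢ l≢j , refl)
  thick-separated (Cv i) (Cv j) ci≢cj = inj₁ (not-≟-≢ (ci≢cj ∘ cong Cv))
  thick-separated (Cv i) (Sv j) _ with i ≟ j
  ... | no _ = inj₁ refl
  ... | yes refl = let (l , l≢i , _) = avoid i i in inj₂ (Cv l , not-≟-≢ (l≢i ∘ sym) , not-≟-≢ l≢i)
  thick-separated (Sv j) (Cv i) _ with i ≟ j
  ... | no _ = inj₁ refl
  ... | yes refl = let (l , l≢i , _) = avoid i i in inj₂ (Cv l , not-≟-≢ l≢i , not-≟-≢ (l≢i ∘ sym))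
  thick-separated (Sv i) (Sv j) _ = let (l , l≢i , l≢j) = avoid i j in inj₂ (Cv l , not-≟-≢ l≢i , not-≟-≢ l≢j)

  thick-noIsolated : ∀ (a : SpBase r (suc (suc (suc k)))) → ∃[ w ] spAdj false adjR a w ≡ true
  thick-noIsolated (Rv _) = Cv zero , refl
  thick-noIsolated (Cv i) = let (l , l≢i , _) = avoid i i in Cv l , not-≟-≢ (l≢i ∘ sym)
  thick-noIsolated (Sv i) = let (l , l≢i , _) = avoid i i in Cv l , not-≟-≢ l≢i

thick-χh : ∀ {n} (G : Graph n) r k (adjR : Fin r → Fin r → Bool) (tw : TwinSpec (suc (suc (suc k)))) →
  G ≅ qsAdj false r (suc (suc (suc k))) adjR tw → ChiH≡ G n
thick-χh G r k adjR tw iso = diameter≤2⇒χh≡n iso λ x y x≢y →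
  qs-separated false adjR (thick-noIsolated adjR) x y x≢y (thick-separated adjR (base x) (base y))

swapS : ∀ {r} → SpBase r 2 → SpBase r 2
swapS (Rv i) = Rv i
swapS (Cv i) = Cv i
swapS (Sv i) = Sv (opposite i)

swapS-involutive : ∀ {r} (x : SpBase r 2) → swapS (swapS x) ≡ x
swapS-involutive (Rv i) = refl
swapS-involutive (Cv i) = refl
swapS-involutive (Sv i) = cong Sv (opposite-involutive i)

swapLeg : Fin 2 ⊎ Fin 2 → Fin 2 ⊎ Fin 2
swapLeg (inj₁ i) = inj₁ i
swapLeg (inj₂ i) = inj₂ (opposite i)

swapTwin : TwinSpec 2 → TwinSpec 2
swapTwin = Maybe.map (map₂ swapLeg)

thick-legAdj≡thin-opposite : ∀ (i j : Fin 2) → legAdj false i j ≡ legAdj true i (opposite j)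
thick-legAdj≡thin-opposite zero zero = refl
thick-legAdj≡thin-opposite zero (suc zero) = refl
thick-legAdj≡thin-opposite (suc zero) zero = refl
thick-legAdj≡thin-opposite (suc zero) (suc zero) = refl

opposite-≟ : ∀ (i j : Fin 2) → ⌊ opposite i ≟ opposite j ⌋ ≡ ⌊ i ≟ j ⌋
opposite-≟ zero zero = refl
opposite-≟ zero (suc zero) = refl
opposite-≟ (suc zero) zero = refl
opposite-≟ (suc zero) (suc zero) = refl

module _ {r : ℕ} (adjR : Fin r → Fin r → Bool) where

  spAdj-thick≡thin-swapS : ∀ (x y : SpBase r 2) → spAdj false adjR x y ≡ spAdj true adjR (swapS x) (swapS y)
  spAdj-thick≡thin-swapS (Rv i) (Rv j) = refl
  spAdj-thick≡thin-swapS (Rv i) (Cv j) = refl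
  spAdj-thick≡thin-swapS (Rv i) (Sv j) = refl
  spAdj-thick≡thin-swapS (Cv i) (Rv j) = refl
  spAdj-thick≡thin-swapS (Cv i) (Cv j) = refl
  spAdj-thick≡thin-swapS (Cv i) (Sv j) = thick-legAdj≡thin-opposite i j
  spAdj-thick≡thin-swapS (Sv i) (Rv j) = refl
  spAdj-thick≡thin-swapS (Sv i) (Cv j) = thick-legAdj≡thin-opposite j i
  spAdj-thick≡thin-swapS (Sv i) (Sv j) = refl

  isOrig-swap : ∀ t (x : SpBase r 2) → isOrig (swapLeg t) (swapS x) ≡ isOrig t x
  isOrig-swap (inj₁ t) (Rv i) = refl
  isOrig-swap (inj₁ t) (Cv i) = refl
  isOrig-swap (inj₁ t) (Sv i) = refl
  isOrig-swap (inj₂ t) (Rv i) = refl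
  isOrig-swap (inj₂ t) (Cv i) = refl
  isOrig-swap (inj₂ t) (Sv i) = opposite-≟ t i

  twinAdj-thick≡thin-swap : ∀ b t (x : SpBase r 2) →
    twinAdj false adjR b t x ≡ twinAdj true adjR b (swapLeg t) (swapS x)
  twinAdj-thick≡thin-swap b (inj₁ t) x =
    cong₂ (λ c e → if c then b else e) (sym (isOrig-swap (inj₁ t) x)) (spAdj-thick≡thin-swapS x (Cv t))
  twinAdj-thick≡thin-swap b (inj₂ t) x =
    cong₂ (λ c e → if c then b else e) (sym (isOrig-swap (inj₂ t) x)) (spAdj-thick≡thin-swapS x (Sv t))

  swapQS : ∀ {tw} → QSV r 2 tw → QSV r 2 (swapTwin tw)
  swapQS (inj₁ x) = inj₁ (swapS x)
  swapQS {just _} (inj₂ _) = inj₂ tt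

  unswapQS : ∀ {tw} → QSV r 2 (swapTwin tw) → QSV r 2 tw
  unswapQS (inj₁ x) = inj₁ (swapS x)
  unswapQS {just _} (inj₂ _) = inj₂ tt

  swapQS-unswapQS : ∀ {tw} (x : QSV r 2 (swapTwin tw)) → swapQS (unswapQS {tw} x) ≡ x
  swapQS-unswapQS (inj₁ x) = cong inj₁ (swapS-involutive x)
  swapQS-unswapQS {just _} (inj₂ _) = refl

  unswapQS-swapQS : ∀ {tw} (x : QSV r 2 tw) → unswapQS (swapQS x) ≡ x
  unswapQS-swapQS (inj₁ x) = cong inj₁ (swapS-involutive x)
  unswapQS-swapQS {just _} (inj₂ _) = refl

  swapQS↔ : ∀ {tw} → QSV r 2 tw ↔ QSV r 2 (swapTwin tw)
  swapQS↔ {tw} = mk↔ₛ′ swapQS unswapQS (swapQS-unswapQS {tw}) unswapQS-swapQS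

  qsAdj-thick≡thin-swap : ∀ {tw} (x y : QSV r 2 tw) →
    qsAdj false r 2 adjR tw x y ≡ qsAdj true r 2 adjR (swapTwin tw) (swapQS x) (swapQS y)
  qsAdj-thick≡thin-swap (inj₁ x) (inj₁ y) = spAdj-thick≡thin-swapS x y
  qsAdj-thick≡thin-swap {just (b , t)} (inj₁ x) (inj₂ _) = twinAdj-thick≡thin-swap b t x
  qsAdj-thick≡thin-swap {just (b , t)} (inj₂ _) (inj₁ x) = twinAdj-thick≡thin-swap b t x
  qsAdj-thick≡thin-swap {just _} (inj₂ _) (inj₂ _) = refl

thick₂⇒thin : ∀ {n} (G : Graph n) r (adjR : Fin r → Fin r → Bool) (tw : TwinSpec 2) →
  G ≅ qsAdj false r 2 adjR tw → IsThinQuasiSpider G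
thick₂⇒thin G r adjR tw iso =
  r , 2 , adjR , swapTwin tw , s≤s (s≤s z≤n) , ≅-transport (swapQS↔ adjR) (qsAdj-thick≡thin-swap adjR) iso

-- Thin quasi-spiders

OnlyLeg : ∀ {r k} → Fin k → SpBase r k → Set
OnlyLeg z (Sv i) = i ≡ z
OnlyLeg z _ = ⊤

module _ {r k : ℕ} (adjR : Fin r → Fin r → Bool) where

  thin-separated : (z : Fin k) (a b : SpBase r k) → OnlyLeg z a → OnlyLeg z b → a ≢ b →
    Separated (spAdj true adjR) a b
  thin-separated z (Rv _) (Rv _) _ _ _ = inj₂ (Cv z , refl , refl)
  thin-separated z (Rv _) (Cv _) _ _ _ = inj₁ refl
  thin-separated z (Cv _) (Rv _) _ _ _ = inj₁ refl
  thin-separated z (Rv _) (Sv j) _ _ _ = inj₂ (Cv j , refl , ≟-refl j)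
  thin-separated z (Sv j) (Rv _) _ _ _ = inj₂ (Cv j , ≟-refl j , refl)
  thin-separated z (Cv i) (Cv j) _ _ ci≢cj = inj₁ (not-≟-≢ (ci≢cj ∘ cong Cv))
  thin-separated z (Cv i) (Sv j) _ _ _ with i ≟ j
  ... | yes refl = inj₁ refl
  ... | no i≢j = inj₂ (Cv j , not-≟-≢ i≢j , ≟-refl j)
  thin-separated z (Sv j) (Cv i) _ _ _ with i ≟ j
  ... | yes refl = inj₁ refl
  ... | no i≢j = inj₂ (Cv j , ≟-refl j , not-≟-≢ i≢j)
  thin-separated z (Sv i) (Sv j) refl refl si≢sj = ⊥-elim (si≢sj refl)

  thin-noIsolated : Fin k → ∀ (a : SpBase r k) → ∃[ w ] spAdj true adjR a w ≡ true
  thin-noIsolated z (Rv _) = Cv z , refl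
  thin-noIsolated z (Cv i) = Sv i , ≟-refl i
  thin-noIsolated z (Sv i) = Cv i , ≟-refl i

twinCount : ∀ {k} → TwinSpec k → ℕ
twinCount nothing = 0
twinCount (just _) = 1

Palette : (r k : ℕ) → TwinSpec k → Set
Palette r k tw = (Fin r ⊎ (Fin k ⊎ Fin (twinCount tw))) ⊎ Fin 1

palette↔ : ∀ r k (tw : TwinSpec k) → Fin (r + (k + twinCount tw) + 1) ↔ Palette r k tw
palette↔ r k tw = ↔-trans +↔⊎ (↔-trans +↔⊎ (↔-refl ⊎-↔ +↔⊎) ⊎-↔ ↔-refl)

twinCount-size : ∀ {k} (tw : TwinSpec k) → k + twinCount tw ≡ sizeC tw ⊔ sizeS tw
twinCount-size {k} nothing = trans (+-identityʳ k) (sym (⊔-idem k))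
twinCount-size {k} (just (_ , inj₁ _)) = trans (+-comm k 1) (sym (m≥n⇒m⊔n≡m (n≤1+n k)))
twinCount-size {k} (just (_ , inj₂ _)) = trans (+-comm k 1) (sym (m≤n⇒m⊔n≡n (n≤1+n k)))

-- The replaced vertex, if it lies in S, is the one S-vertex chosen as representative.
sFoot : ∀ {k} → Fin k → TwinSpec k → Fin k
sFoot _ (just (_ , inj₂ t)) = t
sFoot z _ = z

InBaseS : ∀ {r k} {tw : TwinSpec k} → QSV r k tw → Set
InBaseS x = ∃[ i ] x ≡ inj₁ (Sv i)

module _ {r k : ℕ} where

  thinColour : ∀ {tw} → QSV r k tw → Palette r k tw
  thinColour (inj₁ (Rv i)) = inj₁ (inj₁ i)
  thinColour (inj₁ (Cv i)) = inj₁ (inj₂ (inj₁ i))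
  thinColour (inj₁ (Sv _)) = inj₂ zero
  thinColour {just _} (inj₂ _) = inj₁ (inj₂ (inj₂ zero))

  thinColour-fibres : ∀ {tw} (x y : QSV r k tw) → thinColour x ≡ thinColour y → x ≡ y ⊎ (InBaseS x × InBaseS y)
  thinColour-fibres (inj₁ (Rv i)) (inj₁ (Rv .i)) refl = inj₁ refl
  thinColour-fibres (inj₁ (Cv i)) (inj₁ (Cv .i)) refl = inj₁ refl
  thinColour-fibres (inj₁ (Sv i)) (inj₁ (Sv j)) _ = inj₂ ((i , refl) , (j , refl))
  thinColour-fibres {just _} (inj₂ _) (inj₂ _) _ = inj₁ refl
  thinColour-fibres (inj₁ (Rv _)) (inj₁ (Cv _)) ()
  thinColour-fibres (inj₁ (Rv _)) (inj₁ (Sv _)) ()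
  thinColour-fibres (inj₁ (Cv _)) (inj₁ (Rv _)) ()
  thinColour-fibres (inj₁ (Cv _)) (inj₁ (Sv _)) ()
  thinColour-fibres (inj₁ (Sv _)) (inj₁ (Rv _)) ()
  thinColour-fibres (inj₁ (Sv _)) (inj₁ (Cv _)) ()
  thinColour-fibres {just _} (inj₁ (Rv _)) (inj₂ _) ()
  thinColour-fibres {just _} (inj₁ (Cv _)) (inj₂ _) ()
  thinColour-fibres {just _} (inj₁ (Sv _)) (inj₂ _) ()
  thinColour-fibres {just _} (inj₂ _) (inj₁ (Rv _)) ()
  thinColour-fibres {just _} (inj₂ _) (inj₁ (Cv _)) ()
  thinColour-fibres {just _} (inj₂ _) (inj₁ (Sv _)) ()


  representative : ∀ {tw} → Fin k → Palette r k tw → QSV r k tw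
  representative z (inj₁ (inj₁ i)) = inj₁ (Rv i)
  representative z (inj₁ (inj₂ (inj₁ i))) = inj₁ (Cv i)
  representative {just _} z (inj₁ (inj₂ (inj₂ _))) = inj₂ tt
  representative {tw} z (inj₂ _) = inj₁ (Sv (sFoot z tw))

  thinColour-representative : ∀ {tw} z (p : Palette r k tw) → thinColour (representative z p) ≡ p
  thinColour-representative z (inj₁ (inj₁ i)) = refl
  thinColour-representative z (inj₁ (inj₂ (inj₁ i))) = refl
  thinColour-representative {just _} z (inj₁ (inj₂ (inj₂ zero))) = refl
  thinColour-representative z (inj₂ zero) = refl

  representative-onlyLeg : ∀ {tw} z (p : Palette r k tw) → OnlyLeg (sFoot z tw) (base (representative z p))
  representative-onlyLeg z (inj₁ (inj₁ _)) = tt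
  representative-onlyLeg z (inj₁ (inj₂ (inj₁ _))) = tt
  representative-onlyLeg {just (_ , inj₁ _)} z (inj₁ (inj₂ (inj₂ _))) = tt
  representative-onlyLeg {just (_ , inj₂ _)} z (inj₁ (inj₂ (inj₂ _))) = refl
  representative-onlyLeg z (inj₂ _) = refl

module _ {r k : ℕ} (adjR : Fin r → Fin r → Bool) where

  thin-S-independent : ∀ {tw} (x y : QSV r k tw) → InBaseS x → InBaseS y → qsAdj true r k adjR tw x y ≡ false
  thin-S-independent _ _ (_ , refl) (_ , refl) = refl

  S-neighbour-index : ∀ {tw} (v : QSV r k tw) i j → qsAdj true r k adjR tw v (inj₁ (Sv i)) ≡ true →
    qsAdj true r k adjR tw v (inj₁ (Sv j)) ≡ true → i ≡ j
  S-neighbour-index (inj₁ (Cv l)) i j p q = trans (sym (≟-sound p)) (≟-sound q)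
  S-neighbour-index {just (_ , inj₁ c)} (inj₂ _) i j p q = trans (sym (≟-sound p)) (≟-sound q)
  S-neighbour-index {just (_ , inj₂ s)} (inj₂ _) i j p q =
    trans (sym (≟-sound (if-else-false ⌊ s ≟ i ⌋ p))) (≟-sound (if-else-false ⌊ s ≟ j ⌋ q))

  thin-S-privateNeighbours : ∀ {tw} (v x y : QSV r k tw) → qsAdj true r k adjR tw v x ≡ true →
    qsAdj true r k adjR tw v y ≡ true → InBaseS x → InBaseS y → x ≡ y
  thin-S-privateNeighbours v _ _ p q (i , refl) (j , refl) = cong (inj₁ ∘ Sv) (S-neighbour-index v i j p q)

thin-χh : ∀ {n} (G : Graph n) r k (adjR : Fin r → Fin r → Bool) (tw : TwinSpec (suc k)) →
  G ≅ qsAdj true r (suc k) adjR tw → ChiH≡ G (r + (suc k + twinCount tw) + 1)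
thin-χh G r k adjR tw iso =
  ChiH≡-intro G (κ ∘ _≅_.to iso , ≅-harmonious iso κ proper edge-injective)
    (λ _ → separatedFamily⇒≤ iso family family-injective family-separated)
  where
  palette = palette↔ r (suc k) tw
  A = qsAdj true r (suc k) adjR tw

  κ : QSV r (suc k) tw → Fin (r + (suc k + twinCount tw) + 1)
  κ = Inverse.from palette ∘ thinColour

  κ-fibres : ∀ x y → κ x ≡ κ y → x ≡ y ⊎ (InBaseS x × InBaseS y)
  κ-fibres x y eq = thinColour-fibres x y (↔-from-injective palette eq)

  proper : ProperOn A κ
  proper = collapse-proper (≅-sym iso) (≅-irrefl iso) κ-fibres (thin-S-independent adjR) (thin-S-privateNeighbours adjR)

  edge-injective : EdgeInjectiveOn A κ
  edge-injective = collapse-edgeInjective (≅-sym iso) (≅-irrefl iso) κ-fibres (thin-S-independent adjR) (thin-S-privateNeighbours adjR)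

  family : Fin (r + (suc k + twinCount tw) + 1) → QSV r (suc k) tw
  family = representative zero ∘ Inverse.to palette

  family-injective : Injective _≡_ _≡_ family
  family-injective {i} {j} eq = ↔-to-injective palette (begin
    Inverse.to palette i                ≡⟨ sym (thinColour-representative zero _) ⟩
    thinColour (family i)               ≡⟨ cong thinColour eq ⟩
    thinColour (family j)               ≡⟨ thinColour-representative zero _ ⟩
    Inverse.to palette j                ∎)
    where open ≡-Reasoning

  family-separated : ∀ i j → family i ≢ family j → Separated A (family i) (family j)
  family-separated i j fi≢fj = qs-separated true adjR (thin-noIsolated adjR zero) _ _ fi≢fj
    (thin-separated adjR (sFoot zero tw) (base (family i)) (base (family j)) (representative-onlyLeg zero (Inverse.to palette i))
      (representative-onlyLeg zero (Inverse.to palette j)))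

lemma3p5 : ∀ {n} (G : Graph n) →
    (∀ {n₁ n₂} (G₁ : Graph (suc n₁)) (G₂ : Graph (suc n₂)) → G ≅ joinAdj G₁ G₂ → ChiH≡ G n)
    × (∀ r k (adjR : Fin r → Fin r → Bool) (tw : TwinSpec k) →
        IsQuasiSpider G true r k adjR tw → ChiH≡ G (r + (sizeC tw ⊔ sizeS tw) + 1))
    × (∀ r k (adjR : Fin r → Fin r → Bool) (tw : TwinSpec k) →
        IsQuasiSpider G false r k adjR tw → ¬ IsThinQuasiSpider G → ChiH≡ G n)
lemma3p5 G = join , thin , thick
  where
  join : ∀ {n₁ n₂} (G₁ : Graph (suc n₁)) (G₂ : Graph (suc n₂)) → G ≅ joinAdj G₁ G₂ → ChiH≡ G _
  join G₁ G₂ iso = diameter≤2⇒χh≡n iso (λ x y _ → join-separated G₁ G₂ x y)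

  thin : ∀ r k (adjR : Fin r → Fin r → Bool) (tw : TwinSpec k) →
    IsQuasiSpider G true r k adjR tw → ChiH≡ G (r + (sizeC tw ⊔ sizeS tw) + 1)
  thin r (suc k) adjR tw (_ , iso) =
    subst (ChiH≡ G) (cong (λ s → r + s + 1) (twinCount-size tw)) (thin-χh G r k adjR tw iso)

  thick : ∀ r k (adjR : Fin r → Fin r → Bool) (tw : TwinSpec k) →
    IsQuasiSpider G false r k adjR tw → ¬ IsThinQuasiSpider G → ChiH≡ G _
  thick r (suc (suc zero)) adjR tw (_ , iso) notThin = ⊥-elim (notThin (thick₂⇒thin G r adjR tw iso))
  thick r (suc (suc (suc k))) adjR tw (_ , iso) _ = thick-χh G r k adjR tw iso
  thick r (suc zero) adjR tw (s≤s () , _) _
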